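{- Let $GX=2\times X^{\mathbb{A}}\times[\mathbb{A}]X$ on $\mathsf{Nom}$, $T=\mathcal{P}_{\mathsf{ufs}}$ with multiplication $\mu$, and let $\rho$ and $\varepsilon$ be as below. Let $k\colon\bar{\mathbb{A}}^*/{=_\alpha}\to T F(\bar{\mathbb{A}}^*/{=_\alpha})$ (with $FX=1+\mathbb{A}\times X+[\mathbb{A}]X$) be given by $k([\varepsilon]_\alpha)=\{\ast\}$, $k([av]_\alpha)=\{(a,[v]_\alpha)\}$, $k([{|}a\,v]_\alpha)=\{\langle a\rangle[v]_\alpha\}$, and let $\gamma=G\mu\cdot\rho_{T(\bar{\mathbb{A}}^*/{=_\alpha})}\cdot T(\varepsilon\cdot k)\colon T(\bar{\mathbb{A}}^*/{=_\alpha})\to GT(\bar{\mathbb{A}}^*/{=_\alpha})$ (the homomorphic extension of $\varepsilon\cdot k$). Then the unique $G$-coalgebra homomorphism $e$ from $(\mathcal{P}_{\mathsf{ufs}}(\bar{\mathbb{A}}^*/{=_\alpha}),\gamma)$ to the terminal $G$-coalgebra $(\mathcal{P}_{\mathsf{fs}}(\bar{\mathbb{A}}^*/{=_\alpha}),\tau)$ is the inclusion map $\mathcal{P}_{\mathsf{ufs}}(\bar{\mathbb{A}}^*/{=_\alpha})\hookrightarrow\mathcal{P}_{\mathsf{fs}}(\bar{\mathbb{A}}^*/{=_\alpha})$.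
   Context: Fix a countably infinite set $\mathbb{A}$ of names; nominal sets carry an action of the finite permutations of $\mathbb{A}$ with every element $x$ finitely supported (least support $\mathrm{supp}(x)$; $d$ fresh for $x$ if $d\notin\mathrm{supp}(x)$); $\mathsf{Nom}$ is the category of nominal sets and equivariant maps; $X^{\mathbb{A}}$ is the exponential; $1=\{\ast\}$, $2=\{0,1\}$. $\mathcal{P}_{\mathsf{fs}}X$ / $\mathcal{P}_{\mathsf{ufs}}X$ are the finitely supported / uniformly finitely supported subsets of $X$; $\mathcal{P}_{\mathsf{ufs}}$ is a monad with unit singleton and multiplication union. $[\mathbb{A}]X$ is the quotient of $\mathbb{A}\times X$ by $(a,x)\sim(b,y)$ iff $(a\,c)\cdot x=(b\,c)\cdot y$ for a fresh $c$, classes $\langle a\rangle x$. Bar strings are words over $\bar{\mathbb{A}}=\mathbb{A}\cup\{{|}a:a\in\mathbb{A}\}$; $=_\alpha$ is the least equivalence with $x\,{|}a\,v=_\alpha x\,{|}b\,w$ whenever $\langle a\rangle v=\langle b\rangle w$; $[w]_\alpha$ is the class. $\varepsilon_X\colon\mathcal{P}_{\mathsf{ufs}}FX\to G\mathcal{P}_{\mathsf{ufs}}X$ is $\varepsilon_X(S)=(b,\,a\mapsto\{x:(a,x)\in S\},\,\langle d\rangle\{x:\langle d\rangle x\in S\})$ with $b=1$ iff $\ast\in S$, $d$ fresh for $S$. $\rho_X\colon\mathcal{P}_{\mathsf{ufs}}GX\to G\mathcal{P}_{\mathsf{ufs}}X$ is $\rho_X(S)=(b,\,a\mapsto\{f(a):f\in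 p_1[S]\},\,\langle d\rangle\{x:\langle d\rangle x\in p_2[S]\})$ with $b=1$ iff $1\in p_0[S]$, $d$ fresh for $S$, $p_i$ the product projections. The terminal $G$-coalgebra structure is $\tau(S)=(b_S,\,a\mapsto\{[w]_\alpha:[aw]_\alpha\in S\},\,\langle d\rangle\{[w]_\alpha:[{|}d\,w]_\alpha\in S\})$ with $b_S=1$ iff $[\varepsilon]_\alpha\in S$ and $d$ fresh for $S$. -}

module Defs where

-- Nominal structure is given by swappings (transpositions
-- generate the finite permutations).  Elements of quotients are represented by
-- representatives together with the quotient relation (setoid style).
-- Subsets are Set-valued predicates; each carries a chosen finite support list
-- (data), which is used to make the "d fresh for S" choices of the paper
-- computable.  Whether the list really is a (uniform) support is a separate
-- predicate (IsFS / IsUFS).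

open import Data.Nat using (ℕ; suc; _≡ᵇ_; _⊔_)
open import Data.Bool using (if_then_else_)
open import Data.List using (List; []; _∷_; _++_; map; foldr)
open import Data.List.Membership.Propositional using (_∉_)
open import Data.Product using (Σ; _×_; _,_; ∃)
open import Data.Unit using (⊤)
open import Data.Empty using (⊥)
open import Relation.Binary.PropositionalEquality using (_≡_)
open import Function.Bundles using (_⇔_)

Name : Set
Name = ℕ

swapN : Name → Name → Name → Name
swapN a b c = if c ≡ᵇ a then b else (if c ≡ᵇ b then a else c)

fresh : List Name → Name
fresh L = suc (foldr _⊔_ 0 L)

data Letter : Set where
  nm : Name → Letter
  br : Name → Letter

BS : Set
BS = List Letter

swapL : Name → Name → Letter → Letter
swapL a b (nm c) = nm (swapN a b c)
swapL a b (br c) = br (swapN a b c)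

swapBS : Name → Name → BS → BS
swapBS a b = map (swapL a b)

letterName : Letter → Name
letterName (nm c) = c
letterName (br c) = c

names : BS → List Name
names = map letterName

-- α-equivalence: the least equivalence with  x |a v =α x |b w  whenever
-- ⟨a⟩v = ⟨b⟩w in [𝔸]Ā*, i.e. (a c)·v = (b c)·w for some c fresh for a,b,v,w.
data _=α_ : BS → BS → Set where
  α-step  : ∀ x a b v w c → c ∉ (a ∷ b ∷ names v ++ names w) →
            swapBS a c v ≡ swapBS b c w →
            (x ++ br a ∷ v) =α (x ++ br b ∷ w)
  α-refl  : ∀ u → u =α u
  α-sym   : ∀ {u v} → u =α v → v =α u
  α-trans : ∀ {u v w} → u =α v → v =α w → u =α w

record Sub : Set₁ where
  field
    mem  : BS → Set
    supp : List Name
open Sub public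

_≐_ : Sub → Sub → Set
S ≐ T = ∀ w → mem S w ⇔ mem T w

swapSub : Name → Name → Sub → Sub
swapSub a b S = record { mem = λ w → mem S (swapBS a b w)
                       ; supp = map (swapN a b) (supp S) }

-- S is a subset of the quotient Ā*/=α
RespectsAlpha : Sub → Set
RespectsAlpha S = ∀ u v → u =α v → mem S u → mem S v

-- supp S is a support of S :  S ∈ 𝒫_fs(Ā*/=α)
IsFS : Sub → Set
IsFS S = RespectsAlpha S ×
         (∀ a b → a ∉ supp S → b ∉ supp S → ∀ w → mem S w ⇔ mem S (swapBS a b w))

-- supp S supports every element of S :  S ∈ 𝒫_ufs(Ā*/=α)
IsUFS : Sub → Set
IsUFS S = RespectsAlpha S ×
          (∀ w → mem S w → ∀ a b → a ∉ supp S → b ∉ supp S → swapBS a b w =α w)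

data FX : Set where
  star : FX
  pair : Name → BS → FX
  abs  : Name → BS → FX

_≈F_ : FX → FX → Set
star     ≈F star     = ⊤
star     ≈F pair _ _ = ⊥
star     ≈F abs _ _  = ⊥
pair _ _ ≈F star     = ⊥
pair a v ≈F pair b w = (a ≡ b) × (v =α w)
pair _ _ ≈F abs _ _  = ⊥
abs _ _  ≈F star     = ⊥
abs _ _  ≈F pair _ _ = ⊥
abs a v  ≈F abs b w  = ∃ λ c → (c ∉ (a ∷ b ∷ names v ++ names w)) ×
                               (swapBS a c v =α swapBS b c w)

record SubF : Set₁ where
  field
    memF  : FX → Set
    suppF : List Name
open SubF public

k : BS → SubF
k []         = record { memF = λ y → y ≈F star     ; suppF = [] }
k (nm a ∷ v) = record { memF = λ y → y ≈F pair a v ; suppF = names (nm a ∷ v) }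
k (br a ∷ v) = record { memF = λ y → y ≈F abs a v  ; suppF = names (br a ∷ v) }

-- G(𝒫 X) = 2 × (𝒫 X)^𝔸 × [𝔸](𝒫 X)   (2 rendered as propositions, Set)

record GP : Set₁ where
  field
    two     : Set
    fn      : Name → Sub
    fnSupp  : List Name
    absName : Name
    absBody : Sub
open GP public

AbsEq : Name → Sub → Name → Sub → Set
AbsEq a A b B = ∃ λ c → (c ∉ (a ∷ b ∷ supp A ++ supp B)) ×
                        (swapSub a c A ≐ swapSub b c B)

_≈G_ : GP → GP → Set
g ≈G h = (two g ⇔ two h) ×
         (∀ a → fn g a ≐ fn h a) ×
         AbsEq (absName g) (absBody g) (absName h) (absBody h)

Gmap : (Sub → Sub) → GP → GP
Gmap e g = record { two = two g ; fn = λ a → e (fn g a) ; fnSupp = fnSupp g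
                  ; absName = absName g ; absBody = e (absBody g) }

ε : SubF → GP
ε S = record
  { two     = memF S star
  ; fn      = λ a → record { mem = λ x → memF S (pair a x) ; supp = a ∷ suppF S }
  ; fnSupp  = suppF S
  ; absName = d
  ; absBody = record { mem = λ x → memF S (abs d x) ; supp = d ∷ suppF S }
  }
  where d = fresh (suppF S)

τ : Sub → GP
τ S = record
  { two     = mem S []
  ; fn      = λ a → record { mem = λ w → mem S (nm a ∷ w) ; supp = a ∷ supp S }
  ; fnSupp  = supp S
  ; absName = d
  ; absBody = record { mem = λ w → mem S (br d ∷ w) ; supp = d ∷ supp S }
  }
  where d = fresh (supp S)

conc : Name → Sub → Name → Sub
conc a Z d = swapSub a d Z

-- Homomorphic extension  G μ · ρ_{T X} · T g  of g : X → G T X,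
-- written in predicative (fused) form: Agda's predicative universes do not
-- allow μ and ρ to be applied separately without raising universe levels.
--   b      :  ∃ x ∈ S. b(g x)
--   a ↦    ⋃_{x ∈ S} (g x)₁(a)
--   ⟨d⟩    ⋃_{x ∈ S} {y : ⟨d⟩y ∈ {(g x)₂}}  =  ⟨d⟩ ⋃_{x∈S} concretion of (g x)₂ at d
-- with d fresh for S (= fresh for T g S).
hext : (BS → GP) → Sub → GP
hext g S = record
  { two     = Σ BS λ w → mem S w × two (g w)
  ; fn      = λ a → record { mem = λ y → Σ BS λ w → mem S w × mem (fn (g w) a) y
                           ; supp = a ∷ supp S }
  ; fnSupp  = supp S
  ; absName = d
  ; absBody = record { mem = λ y → Σ BS λ w → mem S w ×
                                     mem (conc (absName (g w)) (absBody (g w)) d) y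
                     ; supp = d ∷ supp S }
  }
  where d = fresh (supp S)

γ : Sub → GP
γ = hext (λ w → ε (k w))

IsCoalgHom : (Sub → Sub) → Set₁
IsCoalgHom e =
  (∀ S → IsUFS S → IsFS (e S)) ×
  (∀ S T → IsUFS S → IsUFS T → S ≐ T → e S ≐ e T) ×
  (∀ a b S → IsUFS S → e (swapSub a b S) ≐ swapSub a b (e S)) ×
  (∀ S → IsUFS S → τ (e S) ≈G Gmap e (γ S))

{-# OPTIONS --safe #-}
-- For uniformly supported S, γ S agrees with τ S componentwise: the flag records [ε] ∈ S,
-- the a-component is {w : aw ∈ S}, and the abstraction is ⟨d⟩{w : |d w ∈ S} for fresh d.
-- The last point is where uniform support is used: the fresh name that ε chooses inside
-- each k w can be swapped with d without leaving S. Hence the identity is a homomorphism.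
-- Conversely, τ · e = G e · γ says that e S has the same flag as S and that the components
-- of e S are the images under e of those of γ S, so induction on the length of a bar string
-- shows that e S and S have the same members; in the bar case both abstractions are read
-- off at one name fresh for everything involved.
module Submission where

open import Defs
open import Data.Bool using (true; false)
open import Data.Empty using (⊥)
open import Data.List using ([]; _∷_; _++_; map; foldr; length)
open import Data.List.Properties using (map-∘; map-cong; map-id; map-++; length-map)
open import Data.List.Membership.Propositional using (_∈_; _∉_)
open import Data.List.Membership.Propositional.Properties using (∈-map⁻; ∈-++⁺ˡ; ∈-++⁺ʳ)
open import Data.List.Relation.Unary.Any using (here; there)
open import Data.Nat using (suc; _≡ᵇ_; _⊔_; _≤_)
open import Data.Nat.Properties using (_≟_; m≤m⊔n; m≤n⊔m; ≤-trans; n≮n; suc-injective)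
open import Data.Product using (_×_; _,_; proj₁; proj₂)
open import Data.Unit using (⊤; tt)
open import Function.Base using (_∘_)
open import Function.Bundles using (_⇔_; mk⇔; Equivalence)
open import Function.Properties.Equivalence using ()
  renaming (refl to ⇔-refl; sym to ⇔-sym; trans to ⇔-trans)
open import Function.Related.Propositional using (module EquationalReasoning; equivalence)
open import Relation.Nullary using (yes; no)
open import Relation.Nullary.Decidable using (dec-true; dec-false)
open import Relation.Binary.PropositionalEquality

-- does (m ≟ n) reduces to m ≡ᵇ n, the test inside swapN.
private
  ≡ᵇ-true : ∀ {m n} → m ≡ n → (m ≡ᵇ n) ≡ true
  ≡ᵇ-true {m} {n} = dec-true (m ≟ n)

  ≡ᵇ-false : ∀ {m n} → m ≢ n → (m ≡ᵇ n) ≡ false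
  ≡ᵇ-false {m} {n} = dec-false (m ≟ n)

swapN-left : ∀ a b → swapN a b a ≡ b
swapN-left a b rewrite ≡ᵇ-true {a} refl = refl

swapN-right : ∀ a b → swapN a b b ≡ a
swapN-right a b with b ≟ a
... | yes refl = swapN-left b b
... | no b≢a rewrite ≡ᵇ-false b≢a | ≡ᵇ-true {b} refl = refl

swapN-fix : ∀ {a b n} → n ≢ a → n ≢ b → swapN a b n ≡ n
swapN-fix n≢a n≢b rewrite ≡ᵇ-false n≢a | ≡ᵇ-false n≢b = refl

swapN-self : ∀ a n → swapN a a n ≡ n
swapN-self a n with n ≟ a
... | yes refl = swapN-left n n
... | no n≢a = swapN-fix n≢a n≢a

swapN-involutive : ∀ a b n → swapN a b (swapN a b n) ≡ n
swapN-involutive a b n with n ≟ a | n ≟ b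
... | yes refl | _ = trans (cong (swapN n b) (swapN-left n b)) (swapN-right n b)
... | no _ | yes refl = trans (cong (swapN a n) (swapN-right a n)) (swapN-left a n)
... | no n≢a | no n≢b = trans (cong (swapN a b) (swapN-fix n≢a n≢b)) (swapN-fix n≢a n≢b)

swapN-injective : ∀ a b {m n} → swapN a b m ≡ swapN a b n → m ≡ n
swapN-injective a b {m} {n} eq = begin
  m                           ≡⟨ swapN-involutive a b m ⟨
  swapN a b (swapN a b m)     ≡⟨ cong (swapN a b) eq ⟩
  swapN a b (swapN a b n)     ≡⟨ swapN-involutive a b n ⟩
  n                           ∎
  where open ≡-Reasoning

swapN-comm : ∀ a b n → swapN a b n ≡ swapN b a n
swapN-comm a b n with n ≟ a | n ≟ b
... | yes refl | yes refl = refl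
... | yes refl | no _ = trans (swapN-left n b) (sym (swapN-right b n))
... | no _ | yes refl = trans (swapN-right a n) (sym (swapN-left n a))
... | no n≢a | no n≢b = trans (swapN-fix n≢a n≢b) (sym (swapN-fix n≢b n≢a))

swapN-conj : ∀ p q a b n →
             swapN p q (swapN a b n) ≡ swapN (swapN p q a) (swapN p q b) (swapN p q n)
swapN-conj p q a b n with n ≟ a | n ≟ b
... | yes refl | _ =
  trans (cong (swapN p q) (swapN-left n b)) (sym (swapN-left (swapN p q n) (swapN p q b)))
... | no _ | yes refl =
  trans (cong (swapN p q) (swapN-right a n)) (sym (swapN-right (swapN p q a) (swapN p q n)))
... | no n≢a | no n≢b =
  trans (cong (swapN p q) (swapN-fix n≢a n≢b))
        (sym (swapN-fix (n≢a ∘ swapN-injective p q) (n≢b ∘ swapN-injective p q)))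

∉-map-swapN : ∀ p q {c L} → c ∉ L → swapN p q c ∉ map (swapN p q) L
∉-map-swapN p q {L = L} c∉L πc∈πL with ∈-map⁻ (swapN p q) {xs = L} πc∈πL
... | _ , n∈L , πc≡πn = c∉L (subst (_∈ L) (sym (swapN-injective p q πc≡πn)) n∈L)

swapL-involutive : ∀ a b l → swapL a b (swapL a b l) ≡ l
swapL-involutive a b (nm c) = cong nm (swapN-involutive a b c)
swapL-involutive a b (br c) = cong br (swapN-involutive a b c)

swapL-self : ∀ a l → swapL a a l ≡ l
swapL-self a (nm c) = cong nm (swapN-self a c)
swapL-self a (br c) = cong br (swapN-self a c)

swapL-comm : ∀ a b l → swapL a b l ≡ swapL b a l
swapL-comm a b (nm c) = cong nm (swapN-comm a b c)
swapL-comm a b (br c) = cong br (swapN-comm a b c)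

swapL-conj : ∀ p q a b l →
             swapL p q (swapL a b l) ≡ swapL (swapN p q a) (swapN p q b) (swapL p q l)
swapL-conj p q a b (nm c) = cong nm (swapN-conj p q a b c)
swapL-conj p q a b (br c) = cong br (swapN-conj p q a b c)

swapL-fix : ∀ {a b} l → letterName l ≢ a → letterName l ≢ b → swapL a b l ≡ l
swapL-fix (nm c) c≢a c≢b = cong nm (swapN-fix c≢a c≢b)
swapL-fix (br c) c≢a c≢b = cong br (swapN-fix c≢a c≢b)

letterName-swapL : ∀ a b l → letterName (swapL a b l) ≡ swapN a b (letterName l)
letterName-swapL a b (nm c) = refl
letterName-swapL a b (br c) = refl

swapBS-involutive : ∀ a b w → swapBS a b (swapBS a b w) ≡ w
swapBS-involutive a b w =
  trans (sym (map-∘ w)) (trans (map-cong (swapL-involutive a b) w) (map-id w))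

swapBS-self : ∀ a w → swapBS a a w ≡ w
swapBS-self a w = trans (map-cong (swapL-self a) w) (map-id w)

swapBS-comm : ∀ a b w → swapBS a b w ≡ swapBS b a w
swapBS-comm a b = map-cong (swapL-comm a b)

swapBS-conj : ∀ p q a b w →
              swapBS p q (swapBS a b w) ≡ swapBS (swapN p q a) (swapN p q b) (swapBS p q w)
swapBS-conj p q a b w =
  trans (sym (map-∘ w)) (trans (map-cong (swapL-conj p q a b) w) (map-∘ w))

swapBS-fresh : ∀ {a b} w → a ∉ names w → b ∉ names w → swapBS a b w ≡ w
swapBS-fresh []      _   _   = refl
swapBS-fresh (l ∷ w) a∉w b∉w =
  cong₂ _∷_ (swapL-fix l (a∉w ∘ here ∘ sym) (b∉w ∘ here ∘ sym))
            (swapBS-fresh w (a∉w ∘ there) (b∉w ∘ there))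

names-swapBS : ∀ a b w → names (swapBS a b w) ≡ map (swapN a b) (names w)
names-swapBS a b w =
  trans (sym (map-∘ w)) (trans (map-cong (letterName-swapL a b) w) (map-∘ w))

swapBS-conj-swap : ∀ {a c c'} → c ≢ a → c' ≢ a → ∀ z →
                   swapBS c c' (swapBS a c (swapBS c c' z)) ≡ swapBS a c' z
swapBS-conj-swap {a} {c} {c'} c≢a c'≢a z = begin
  swapBS c c' (swapBS a c (swapBS c c' z))
    ≡⟨ swapBS-conj c c' a c _ ⟩
  swapBS (swapN c c' a) (swapN c c' c) (swapBS c c' (swapBS c c' z))
    ≡⟨ cong₂ (λ x y → swapBS x y (swapBS c c' (swapBS c c' z)))
             (swapN-fix (≢-sym c≢a) (≢-sym c'≢a)) (swapN-left c c') ⟩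
  swapBS a c' (swapBS c c' (swapBS c c' z))
    ≡⟨ cong (swapBS a c') (swapBS-involutive c c' z) ⟩
  swapBS a c' z
    ∎
  where open ≡-Reasoning

swapBS-shift : ∀ {a c c' x} → c ≢ a → c' ≢ a → c ∉ names x → c' ∉ names x →
               swapBS c c' (swapBS a c x) ≡ swapBS a c' x
swapBS-shift {a} {c} {c'} {x} c≢a c'≢a c∉x c'∉x =
  trans (cong (swapBS c c' ∘ swapBS a c) (sym (swapBS-fresh x c∉x c'∉x)))
        (swapBS-conj-swap c≢a c'≢a x)

≤-foldr-⊔ : ∀ {n} L → n ∈ L → n ≤ foldr _⊔_ 0 L
≤-foldr-⊔ (m ∷ L) (here refl) = m≤m⊔n m _
≤-foldr-⊔ (m ∷ L) (there n∈L) = ≤-trans (≤-foldr-⊔ L n∈L) (m≤n⊔m m _)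

fresh-∉ : ∀ L → fresh L ∉ L
fresh-∉ L fresh∈L = n≮n _ (≤-foldr-⊔ L fresh∈L)

∉-++⁻ˡ : ∀ {x : Name} {xs} ys → x ∉ xs ++ ys → x ∉ xs
∉-++⁻ˡ ys x∉ = x∉ ∘ ∈-++⁺ˡ

∉-++⁻ʳ : ∀ {x : Name} xs {ys} → x ∉ xs ++ ys → x ∉ ys
∉-++⁻ʳ xs x∉ = x∉ ∘ ∈-++⁺ʳ xs

α-cons : ∀ l {u v} → u =α v → (l ∷ u) =α (l ∷ v)
α-cons l (α-step x a b v w c c∉ eq) = α-step (l ∷ x) a b v w c c∉ eq
α-cons l (α-refl u)                 = α-refl (l ∷ u)
α-cons l (α-sym p)                  = α-sym (α-cons l p)
α-cons l (α-trans p q)              = α-trans (α-cons l p) (α-cons l q)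

α-equivariant : ∀ p q {u v} → u =α v → swapBS p q u =α swapBS p q v
α-equivariant p q (α-step x a b v w c c∉ eq) =
  subst₂ _=α_ (sym (map-++ (swapL p q) x (br a ∷ v))) (sym (map-++ (swapL p q) x (br b ∷ w)))
    (α-step (swapBS p q x) (π a) (π b) (swapBS p q v) (swapBS p q w) (π c) πc∉ πeq)
  where
  π = swapN p q
  πc∉ : π c ∉ π a ∷ π b ∷ names (swapBS p q v) ++ names (swapBS p q w)
  πc∉ = subst (π c ∉_)
              (cong (λ ns → π a ∷ π b ∷ ns)
                    (trans (map-++ π (names v) (names w))
                           (sym (cong₂ _++_ (names-swapBS p q v) (names-swapBS p q w)))))
              (∉-map-swapN p q c∉)
  πeq : swapBS (π a) (π c) (swapBS p q v) ≡ swapBS (π b) (π c) (swapBS p q w)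
  πeq = begin
    swapBS (π a) (π c) (swapBS p q v)  ≡⟨ swapBS-conj p q a c v ⟨
    swapBS p q (swapBS a c v)          ≡⟨ cong (swapBS p q) eq ⟩
    swapBS p q (swapBS b c w)          ≡⟨ swapBS-conj p q b c w ⟩
    swapBS (π b) (π c) (swapBS p q w)  ∎
    where open ≡-Reasoning
α-equivariant p q (α-refl u)    = α-refl (swapBS p q u)
α-equivariant p q (α-sym r)     = α-sym (α-equivariant p q r)
α-equivariant p q (α-trans r s) = α-trans (α-equivariant p q r) (α-equivariant p q s)

α-rename : ∀ b c w → c ∉ names w → (br b ∷ w) =α (br c ∷ swapBS b c w)
α-rename b c w c∉w with c ≟ b
... | yes refl = subst (λ z → (br c ∷ w) =α (br c ∷ z)) (sym (swapBS-self c w)) (α-refl _)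
... | no c≢b = α-step [] b c w (swapBS b c w) c' c'∉
                      (sym (swapBS-shift c≢b (c'∉ ∘ here) c∉w c'∉w))
  where
  c' = fresh (b ∷ c ∷ names w ++ names (swapBS b c w))
  c'∉ = fresh-∉ (b ∷ c ∷ names w ++ names (swapBS b c w))
  c'∉w = ∉-++⁻ˡ _ (c'∉ ∘ there ∘ there)

-- An equivalence relation containing the generating steps of =α, hence containing =α;
-- it is what lets a common first letter be cancelled.
AlphaHead : BS → BS → Set
AlphaHead []         []         = ⊤
AlphaHead (nm a ∷ x) (nm b ∷ y) = a ≡ b × x =α y
AlphaHead (br a ∷ x) (br b ∷ y) = ∀ c → c ≢ a → c ≢ b → c ∉ names x → c ∉ names y →
                                  swapBS a c x =α swapBS b c y
AlphaHead _          _          = ⊥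

AlphaHead-refl : ∀ u → AlphaHead u u
AlphaHead-refl []         = tt
AlphaHead-refl (nm a ∷ x) = refl , α-refl x
AlphaHead-refl (br a ∷ x) = λ c _ _ _ _ → α-refl (swapBS a c x)

AlphaHead-sym : ∀ u v → AlphaHead u v → AlphaHead v u
AlphaHead-sym []         []         _        = tt
AlphaHead-sym (nm a ∷ x) (nm b ∷ y) (a≡b , p) = sym a≡b , α-sym p
AlphaHead-sym (br a ∷ x) (br b ∷ y) h        =
  λ c c≢b c≢a c∉y c∉x → α-sym (h c c≢a c≢b c∉x c∉y)

AlphaHead-trans : ∀ u v w → AlphaHead u v → AlphaHead v w → AlphaHead u w
AlphaHead-trans []         []         []         _         _         = tt
AlphaHead-trans (nm a ∷ x) (nm b ∷ y) (nm e ∷ z) (a≡b , p) (b≡e , q) =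
  trans a≡b b≡e , α-trans p q
AlphaHead-trans (br a ∷ x) (br b ∷ y) (br e ∷ z) h₁ h₂ c c≢a c≢e c∉x c∉z =
  subst₂ _=α_ (swapBS-shift c'≢a c≢a c'∉x c∉x) (swapBS-shift c'≢e c≢e c'∉z c∉z)
    (α-equivariant c' c (α-trans (h₁ c' c'≢a c'≢b c'∉x c'∉y)
                                 (h₂ c' c'≢b c'≢e c'∉y c'∉z)))
  where
  L = a ∷ b ∷ e ∷ names x ++ names y ++ names z
  c' = fresh L
  c'∉ = fresh-∉ L
  c'≢a = c'∉ ∘ here
  c'≢b = c'∉ ∘ there ∘ here
  c'≢e = c'∉ ∘ there ∘ there ∘ here
  c'∉x = ∉-++⁻ˡ _ (c'∉ ∘ there ∘ there ∘ there)
  c'∉y = ∉-++⁻ˡ _ (∉-++⁻ʳ (names x) (c'∉ ∘ there ∘ there ∘ there))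
  c'∉z = ∉-++⁻ʳ (names y) (∉-++⁻ʳ (names x) (c'∉ ∘ there ∘ there ∘ there))

=α⇒AlphaHead : ∀ {u v} → u =α v → AlphaHead u v
=α⇒AlphaHead (α-step [] a b v w c c∉ eq) c' c'≢a c'≢b c'∉v c'∉w =
  subst₂ _=α_ (swapBS-shift c≢a c'≢a c∉v c'∉v) (swapBS-shift c≢b c'≢b c∉w c'∉w)
         (subst (λ z → swapBS c c' (swapBS a c v) =α swapBS c c' z) eq (α-refl _))
  where
  c≢a = c∉ ∘ here
  c≢b = c∉ ∘ there ∘ here
  c∉v = ∉-++⁻ˡ _ (c∉ ∘ there ∘ there)
  c∉w = ∉-++⁻ʳ (names v) (c∉ ∘ there ∘ there)
=α⇒AlphaHead (α-step (nm l ∷ x) a b v w c c∉ eq) = refl , α-step x a b v w c c∉ eq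
=α⇒AlphaHead (α-step (br l ∷ x) a b v w c c∉ eq) =
  λ c' _ _ _ _ → α-equivariant l c' (α-step x a b v w c c∉ eq)
=α⇒AlphaHead (α-refl u) = AlphaHead-refl u
=α⇒AlphaHead {u} {v} (α-sym p) = AlphaHead-sym v u (=α⇒AlphaHead p)
=α⇒AlphaHead {u} {w} (α-trans {v = v} p q) = AlphaHead-trans u v w (=α⇒AlphaHead p) (=α⇒AlphaHead q)

nm-α-cancel : ∀ {a x y} → (nm a ∷ x) =α (nm a ∷ y) → x =α y
nm-α-cancel p = proj₂ (=α⇒AlphaHead p)

=α⇒≈F-abs : ∀ {a b v w} → (br a ∷ v) =α (br b ∷ w) → abs a v ≈F abs b w
=α⇒≈F-abs {a} {b} {v} {w} p =
  c , c∉ , =α⇒AlphaHead p c (c∉ ∘ here) (c∉ ∘ there ∘ here)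
                            (∉-++⁻ˡ _ (c∉ ∘ there ∘ there))
                            (∉-++⁻ʳ (names v) (c∉ ∘ there ∘ there))
  where
  c = fresh (a ∷ b ∷ names v ++ names w)
  c∉ = fresh-∉ (a ∷ b ∷ names v ++ names w)

≈F-abs⇒=α : ∀ {a b v w} → abs a v ≈F abs b w → (br a ∷ v) =α (br b ∷ w)
≈F-abs⇒=α {a} {b} {v} {w} (c , c∉ , p) =
  α-trans (α-rename a c v (∉-++⁻ˡ _ (c∉ ∘ there ∘ there)))
          (α-trans (α-cons (br c) p)
                   (α-sym (α-rename b c w (∉-++⁻ʳ (names v) (c∉ ∘ there ∘ there)))))

br-α-cancel : ∀ {d x y} → (br d ∷ x) =α (br d ∷ y) → x =α y
br-α-cancel {d} {x} {y} p with =α⇒≈F-abs p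
... | c , _ , q = subst₂ _=α_ (swapBS-involutive d c x) (swapBS-involutive d c y) (α-equivariant d c q)

mem-resp : ∀ {S u v} → RespectsAlpha S → u =α v → mem S u ⇔ mem S v
mem-resp resp u=v = mk⇔ (resp _ _ u=v) (resp _ _ (α-sym u=v))

isUFS⇒isFS : ∀ {S} → IsUFS S → IsFS S
isUFS⇒isFS (resp , ufs) = resp , λ a b a∉ b∉ w → mk⇔
  (λ w∈S → resp _ _ (α-sym (ufs w w∈S a b a∉ b∉)) w∈S)
  (λ abw∈S → resp _ _ (α-sym (subst (_=α swapBS a b w) (swapBS-involutive a b w)
                                    (ufs (swapBS a b w) abw∈S a b a∉ b∉))) abw∈S)

isUFS-≐ : ∀ {S T} → S ≐ T → supp S ≡ supp T → IsUFS T → IsUFS S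
isUFS-≐ S≐T refl (resp , ufs) =
  (λ u v u=v u∈S → Equivalence.from (S≐T v) (resp u v u=v (Equivalence.to (S≐T u) u∈S))) ,
  (λ w w∈S → ufs w (Equivalence.to (S≐T w) w∈S))

-- For d fresh for S, the swap (d' d) is (e d') ∘ (d e) on w, and (d e) fixes w up to =α.
isUFS-swap-fresh : ∀ {S w d d'} → IsUFS S → mem S w → d ∉ supp S → d' ∉ names w →
                   mem S (swapBS d' d w)
isUFS-swap-fresh {S} {w} {d} {d'} (resp , ufs) w∈S d∉S d'∉w with d ≟ d'
... | yes refl = subst (mem S) (sym (swapBS-self d w)) w∈S
... | no d≢d' = resp _ _ w=d'dw w∈S
  where
  L = d ∷ d' ∷ supp S ++ names w
  e = fresh L
  e∉ = fresh-∉ L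
  e∉w = ∉-++⁻ʳ (supp S) (e∉ ∘ there ∘ there)
  d'd-via-e : swapBS e d' (swapBS d e w) ≡ swapBS d' d w
  d'd-via-e = begin
    swapBS e d' (swapBS d e w)
      ≡⟨ cong (swapBS e d' ∘ swapBS d e) (swapBS-fresh w e∉w d'∉w) ⟨
    swapBS e d' (swapBS d e (swapBS e d' w))
      ≡⟨ swapBS-conj-swap (e∉ ∘ here) (≢-sym d≢d') w ⟩
    swapBS d d' w
      ≡⟨ swapBS-comm d d' w ⟩
    swapBS d' d w
      ∎
    where open ≡-Reasoning
  w=d'dw : w =α swapBS d' d w
  w=d'dw = α-sym (subst₂ _=α_ d'd-via-e (swapBS-fresh w e∉w d'∉w)
                     (α-equivariant e d' (ufs w w∈S d e d∉S (∉-++⁻ˡ _ (e∉ ∘ there ∘ there)))))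

isFS-br-concretion : ∀ {X b w d c} → IsFS X → d ∉ supp X → c ∉ supp X → c ∉ names w →
                     mem X (br b ∷ w) ⇔ mem X (br d ∷ swapBS d c (swapBS b c w))
isFS-br-concretion {X} {b} {w} {d} {c} (resp , inv) d∉X c∉X c∉w = begin
  mem X (br b ∷ w)                         ∼⟨ mem-resp {X} resp (α-rename b c w c∉w) ⟩
  mem X (br c ∷ t)                         ∼⟨ inv d c d∉X c∉X (br c ∷ t) ⟩
  mem X (br (swapN d c c) ∷ swapBS d c t)  ≡⟨ cong (λ x → mem X (br x ∷ swapBS d c t))
                                                   (swapN-right d c) ⟩
  mem X (br d ∷ swapBS d c t)              ∎
  where
  open EquationalReasoning {k = equivalence}
  t = swapBS b c w

-- Moving the witness c of the abstraction equation to c' is conjugation by (c c'),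
-- which fixes both bodies because c and c' are outside their supports.
absEq-fresh : ∀ {a A b B} → IsFS A → IsFS B → AbsEq a A b B →
              ∀ {c'} → c' ∉ a ∷ b ∷ supp A ++ supp B → swapSub a c' A ≐ swapSub b c' B
absEq-fresh {a} {A} {b} {B} (_ , invA) (_ , invB) (c , c∉ , A≐B) {c'} c'∉ z = begin
  mem A (swapBS a c' z)                             ≡⟨ cong (mem A) (swapBS-conj-swap c≢a c'≢a z) ⟨
  mem A (swapBS c c' (swapBS a c (swapBS c c' z)))  ∼⟨ ⇔-sym (invA c c' c∉A c'∉A _) ⟩
  mem A (swapBS a c (swapBS c c' z))                ∼⟨ A≐B (swapBS c c' z) ⟩
  mem B (swapBS b c (swapBS c c' z))                ∼⟨ invB c c' c∉B c'∉B _ ⟩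
  mem B (swapBS c c' (swapBS b c (swapBS c c' z)))  ≡⟨ cong (mem B) (swapBS-conj-swap c≢b c'≢b z) ⟩
  mem B (swapBS b c' z)                             ∎
  where
  open EquationalReasoning {k = equivalence}
  c≢a = c∉ ∘ here
  c≢b = c∉ ∘ there ∘ here
  c∉A = ∉-++⁻ˡ _ (c∉ ∘ there ∘ there)
  c∉B = ∉-++⁻ʳ (supp A) (c∉ ∘ there ∘ there)
  c'≢a = c'∉ ∘ here
  c'≢b = c'∉ ∘ there ∘ here
  c'∉A = ∉-++⁻ˡ _ (c'∉ ∘ there ∘ there)
  c'∉B = ∉-++⁻ʳ (supp A) (c'∉ ∘ there ∘ there)

absBody-τ-isFS : ∀ {X} → IsFS X → IsFS (absBody (τ X))
absBody-τ-isFS {X} (resp , inv) =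
  (λ u v u=v → resp _ _ (α-cons (br d) u=v)) ,
  λ p q p∉ q∉ w → subst (λ x → mem X (br d ∷ w) ⇔ mem X (br x ∷ swapBS p q w))
                        (swapN-fix (≢-sym (p∉ ∘ here)) (≢-sym (q∉ ∘ here)))
                        (inv p q (p∉ ∘ there) (q∉ ∘ there) (br d ∷ w))
  where d = fresh (supp X)

absBody-τ-isUFS : ∀ {X} → IsUFS X → IsUFS (absBody (τ X))
absBody-τ-isUFS {X} (resp , ufs) =
  (λ u v u=v → resp _ _ (α-cons (br d) u=v)) ,
  λ w dw∈X p q p∉ q∉ → br-α-cancel (subst (λ x → (br x ∷ swapBS p q w) =α (br d ∷ w))
                                          (swapN-fix (≢-sym (p∉ ∘ here)) (≢-sym (q∉ ∘ here)))
                                          (ufs (br d ∷ w) dw∈X p q (p∉ ∘ there) (q∉ ∘ there)))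
  where d = fresh (supp X)

fn-τ-isUFS : ∀ {X} → IsUFS X → ∀ a → IsUFS (fn (τ X) a)
fn-τ-isUFS {X} (resp , ufs) a =
  (λ u v u=v → resp _ _ (α-cons (nm a) u=v)) ,
  λ w aw∈X p q p∉ q∉ → nm-α-cancel (subst (λ x → (nm x ∷ swapBS p q w) =α (nm a ∷ w))
                                          (swapN-fix (≢-sym (p∉ ∘ here)) (≢-sym (q∉ ∘ here)))
                                          (ufs (nm a ∷ w) aw∈X p q (p∉ ∘ there) (q∉ ∘ there)))

two-τ⇔γ : ∀ S → two (τ S) ⇔ two (γ S)
two-τ⇔γ S = mk⇔ (λ []∈S → [] , []∈S , tt) from
  where
  from : two (γ S) → mem S []
  from ([]     , []∈S , _) = []∈S
  from (nm _ ∷ _ , _ , ())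
  from (br _ ∷ _ , _ , ())

fn-τ≐γ : ∀ {S} → RespectsAlpha S → ∀ a → fn (τ S) a ≐ fn (γ S) a
fn-τ≐γ {S} resp a y = mk⇔ (λ ay∈S → nm a ∷ y , ay∈S , refl , α-refl y) from
  where
  from : mem (fn (γ S) a) y → mem S (nm a ∷ y)
  from ([]     , _ , ())
  from (nm b ∷ v , av∈S , refl , y=v) = resp _ _ (α-cons (nm a) (α-sym y=v)) av∈S
  from (br _ ∷ _ , _ , ())

absBody-τ≐γ : ∀ {S} → IsUFS S → absBody (τ S) ≐ absBody (γ S)
absBody-τ≐γ {S} U@(resp , _) y = mk⇔ to from
  where
  d = fresh (supp S)
  to : mem S (br d ∷ y) → mem (absBody (γ S)) y
  to dy∈S = br d ∷ y , dy∈S , =α⇒≈F-abs (α-sym dy=d'[dd'y])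
    where
    d' = fresh (d ∷ names y)
    dy=d'[dd'y] : (br d ∷ y) =α (br d' ∷ swapBS d' d y)
    dy=d'[dd'y] = subst (λ z → (br d ∷ y) =α (br d' ∷ z)) (swapBS-comm d d' y)
                        (α-rename d d' y (fresh-∉ (d ∷ names y) ∘ there))
  from : mem (absBody (γ S)) y → mem S (br d ∷ y)
  from ([]     , _ , ())
  from (nm _ ∷ _ , _ , ())
  from (br a ∷ v , av∈S , h) =
    resp _ _ (α-sym dy=d'd[av]) (isUFS-swap-fresh U av∈S (fresh-∉ (supp S)) (fresh-∉ (a ∷ names v)))
    where
    d' = fresh (a ∷ names v)
    dy=d'd[av] : (br d ∷ y) =α swapBS d' d (br a ∷ v)
    dy=d'd[av] = subst (_=α swapBS d' d (br a ∷ v))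
                       (cong₂ (λ x z → br x ∷ z) (swapN-left d' d) (swapBS-involutive d' d y))
                       (α-equivariant d' d (≈F-abs⇒=α h))

≐⇒AbsEq : ∀ {a A B} → A ≐ B → AbsEq a A a B
≐⇒AbsEq {a} {A} {B} A≐B = c , fresh-∉ (a ∷ a ∷ supp A ++ supp B) , λ w → A≐B (swapBS a c w)
  where c = fresh (a ∷ a ∷ supp A ++ supp B)

τ≈Gγ : ∀ {S} → IsUFS S → τ S ≈G γ S
τ≈Gγ {S} U = two-τ⇔γ S , fn-τ≐γ {S} (proj₁ U) ,
              ≐⇒AbsEq {A = absBody (τ S)} {B = absBody (γ S)} (absBody-τ≐γ U)

fn-γ-isUFS : ∀ {S} → IsUFS S → ∀ a → IsUFS (fn (γ S) a)
fn-γ-isUFS {S} U a =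
  isUFS-≐ {fn (γ S) a} (λ w → ⇔-sym (fn-τ≐γ {S} (proj₁ U) a w)) refl (fn-τ-isUFS {S} U a)

absBody-γ-isUFS : ∀ {S} → IsUFS S → IsUFS (absBody (γ S))
absBody-γ-isUFS {S} U =
  isUFS-≐ {absBody (γ S)} (λ w → ⇔-sym (absBody-τ≐γ U w)) refl (absBody-τ-isUFS {S} U)

id-isCoalgHom : IsCoalgHom (λ X → X)
id-isCoalgHom =
  (λ _ → isUFS⇒isFS) , (λ _ _ _ _ S≐T → S≐T) , (λ _ _ _ _ _ → ⇔-refl) , (λ _ → τ≈Gγ)

module _ (e : Sub → Sub) (hom : IsCoalgHom e) where

  private
    e-isFS : ∀ {S} → IsUFS S → IsFS (e S)
    e-isFS = proj₁ hom _

    e-τ≈Gγ : ∀ {S} → IsUFS S → τ (e S) ≈G Gmap e (γ S)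
    e-τ≈Gγ = proj₂ (proj₂ (proj₂ hom)) _

  coalgHom-agrees-br : ∀ {S} → IsUFS S → ∀ b w →
                       (∀ w' → length w' ≡ length w →
                               mem (e (absBody (γ S))) w' ⇔ mem (absBody (γ S)) w') →
                       mem (e S) (br b ∷ w) ⇔ mem S (br b ∷ w)
  coalgHom-agrees-br {S} U b w agrees-B = begin
    mem (e S) (br b ∷ w)
      ∼⟨ isFS-br-concretion {e S} (e-isFS U) (fresh-∉ (supp (e S))) c'∉eS c'∉w ⟩
    mem (e S) (br d₀ ∷ swapBS d₀ c' t)
      ∼⟨ absEq-fresh {A = absBody (τ (e S))} {B = e B} (absBody-τ-isFS (e-isFS U)) (e-isFS UB)
                     (proj₂ (proj₂ (e-τ≈Gγ U))) c'∉Lₐ t ⟩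
    mem (e B) (swapBS d₁ c' t)
      ∼⟨ agrees-B (swapBS d₁ c' t) (trans (length-map _ t) (length-map _ w)) ⟩
    mem B (swapBS d₁ c' t)
      ∼⟨ ⇔-sym (absBody-τ≐γ U (swapBS d₁ c' t)) ⟩
    mem S (br d₁ ∷ swapBS d₁ c' t)
      ∼⟨ ⇔-sym (isFS-br-concretion {S} (isUFS⇒isFS U) (fresh-∉ (supp S)) c'∉S c'∉w) ⟩
    mem S (br b ∷ w)
      ∎
    where
    open EquationalReasoning {k = equivalence}
    B = absBody (γ S)
    UB = absBody-γ-isUFS U
    d₀ = fresh (supp (e S))
    d₁ = fresh (supp S)
    Lₐ = d₀ ∷ d₁ ∷ supp (absBody (τ (e S))) ++ supp (e B)
    c' = fresh (Lₐ ++ supp S ++ names w)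
    c'∉ = fresh-∉ (Lₐ ++ supp S ++ names w)
    c'∉Lₐ = ∉-++⁻ˡ _ c'∉
    c'∉eS = c'∉Lₐ ∘ there ∘ there ∘ ∈-++⁺ˡ ∘ there
    c'∉S = ∉-++⁻ˡ _ (∉-++⁻ʳ Lₐ c'∉)
    c'∉w = ∉-++⁻ʳ (supp S) (∉-++⁻ʳ Lₐ c'∉)
    t = swapBS b c' w

  coalgHom-agrees : ∀ n {S} → IsUFS S → ∀ w → length w ≡ n → mem (e S) w ⇔ mem S w
  coalgHom-agrees _       {S} U []         _   = ⇔-trans (proj₁ (e-τ≈Gγ U)) (⇔-sym (two-τ⇔γ S))
  coalgHom-agrees (suc n) {S} U (nm a ∷ w) |w| = begin
    mem (e S) (nm a ∷ w)    ∼⟨ proj₁ (proj₂ (e-τ≈Gγ U)) a w ⟩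
    mem (e (fn (γ S) a)) w  ∼⟨ coalgHom-agrees n (fn-γ-isUFS U a) w (suc-injective |w|) ⟩
    mem (fn (γ S) a) w      ∼⟨ ⇔-sym (fn-τ≐γ {S} (proj₁ U) a w) ⟩
    mem S (nm a ∷ w)        ∎
    where open EquationalReasoning {k = equivalence}
  coalgHom-agrees (suc n) {S} U (br b ∷ w) |w| =
    coalgHom-agrees-br U b w
      (λ w' |w'| → coalgHom-agrees n (absBody-γ-isUFS U) w' (trans |w'| (suc-injective |w|)))

mainTheorem19 : IsCoalgHom (λ X → X)
                × (∀ (e : Sub → Sub) → IsCoalgHom e → ∀ S → IsUFS S → e S ≐ S)
mainTheorem19 = id-isCoalgHom , λ e hom S U w → coalgHom-agrees e hom (length w) U w refl
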